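{- Let $\beta$ be an arithmetic function with positive integer values, let $x$ be a superadditive arithmetic function with positive integer values, and let $y$ be an arithmetic function with positive integer values. Let $\mathrm{Id}(n)=n$. Then $n!_{\mathrm{Id},\beta}=n!_{x,y}$ for all $n\ge1$ if and only if \[1\star \mathrm{Log}(\beta)=\Delta x\star \mathrm{Log}(y),\] where $1$ denotes the constant function $1(n)=1$.
   Context: An arithmetic function $x:\mathbb{Z}_{\geq1}\to\mathbb{Z}_{>0}$ is superadditive if $x(m)+x(n)\leq x(m+n)$ for all $m,n\geq1$. For superadditive $x$ and positive-integer-valued $y$, the factorial generated by $(x,y)$ is $n!_{x,y}:=\prod_{k=1}^{n}y(k)^{x(\lfloor n/k\rfloor)}$ for $n\geq1$. The difference function is $\Delta x(n):=x(n)-x(n-1)$ for $n\geq1$ with $x(0)=0$. $\mathrm{Log}(\beta)(n):=\log(\beta(n))$. The Dirichlet convolution is $(f\star g)(n)=\sum_{d\mid n}f(n/d)g(d)$. -}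

module Defs where

open import Data.Nat using (ℕ; zero; suc; _+_; _*_; _∸_; _^_; _≤_; _<_)
open import Data.Nat.DivMod using (_/_)
open import Data.Nat.Divisibility using (_∣?_)
open import Data.Bool using (if_then_else_)
open import Relation.Nullary.Decidable using (isYes)

-- Arithmetic functions are modelled as ℕ → ℕ; only arguments n ≥ 1 matter.
ArithFun : Set
ArithFun = ℕ → ℕ

PositiveValued : ArithFun → Set
PositiveValued f = ∀ n → 1 ≤ n → 0 < f n

Superadditive : ArithFun → Set
Superadditive x = ∀ m n → 1 ≤ m → 1 ≤ n → x m + x n ≤ x (m + n)

Id : ArithFun
Id n = n

one : ArithFun
one _ = 1

-- Δx(n) = x(n) - x(n-1), with the convention x(0) = 0 (so Δx(1) = x(1)).
-- (For superadditive positive x, x is strictly increasing, so ∸ never truncates.)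
Δ : ArithFun → ArithFun
Δ x zero = 0
Δ x (suc zero) = x 1
Δ x (suc (suc m)) = x (suc (suc m)) ∸ x (suc m)

prodBelow : ℕ → (ℕ → ℕ) → ℕ
prodBelow zero g = 1
prodBelow (suc n) g = prodBelow n g * g n

-- n!_{x,y} = ∏_{k=1}^{n} y(k)^{x(⌊n/k⌋)}   (k = suc j)
fact : ArithFun → ArithFun → ℕ → ℕ
fact x y n = prodBelow n (λ j → y (suc j) ^ x (n / suc j))

-- Multiplicative (exponentiated) form of Dirichlet convolution with a Log:
--   expConv a b n = ∏_{d ∣ n} b(d)^{a(n/d)},  so that
--   log (expConv a b n) = (a ⋆ Log b)(n).
expConv : ArithFun → ArithFun → ℕ → ℕ
expConv a b n =
  prodBelow n (λ j → if isYes (suc j ∣? n) then b (suc j) ^ a (n / suc j) else 1)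

{-# OPTIONS --safe #-}
-- Since ⌊(n+1)/k⌋ = ⌊n/k⌋ + 1 when k ∣ n+1 and ⌊(n+1)/k⌋ = ⌊n/k⌋ otherwise, and a
-- superadditive x is nondecreasing, passing from n!_{x,y} to (n+1)!_{x,y} multiplies by
-- ∏_{k ∣ n+1} y(k)^{Δx((n+1)/k)} = exp((Δx ⋆ Log y)(n+1)).  So n!_{x,y} is the n-th partial
-- product of exp(Δx ⋆ Log y), and n!_{Id,β} that of exp(1 ⋆ Log β) because ΔId = 1.
-- Partial products of positive factors agree for all n iff the factors agree.
module Submission where

open import Defs
open import Data.Nat using (ℕ; zero; suc; _+_; _*_; _^_; _≤_; _<_; z≤n; s≤s; NonZero; >-nonZero)
open import Data.Nat.Properties
open import Data.Nat.DivMod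
open import Data.Nat.Divisibility using (_∣_; _∣?_; divides; n∣m⇒m%n≡0; ∣-refl)
open import Data.Bool using (if_then_else_)
open import Data.Sum using (inj₁; inj₂)
open import Function using (_∘_)
open import Function.Bundles using (_⇔_; mk⇔)
open import Function.Properties.Equivalence using () renaming (trans to ⇔-trans)
open import Relation.Nullary using (¬_; contradiction)
open import Relation.Nullary.Decidable using (isYes; yes; no)
open import Relation.Binary.PropositionalEquality

prodBelow-cong : ∀ n {f g : ℕ → ℕ} → (∀ j → j < n → f j ≡ g j) → prodBelow n f ≡ prodBelow n g
prodBelow-cong zero    eq = refl
prodBelow-cong (suc n) eq = cong₂ _*_ (prodBelow-cong n (λ j j<n → eq j (m<n⇒m<1+n j<n))) (eq n ≤-refl)

prodBelow-distrib-* : ∀ n (f g : ℕ → ℕ) → prodBelow n (λ j → f j * g j) ≡ prodBelow n f * prodBelow n g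
prodBelow-distrib-* zero    f g = refl
prodBelow-distrib-* (suc n) f g = begin
  prodBelow n (λ j → f j * g j) * (f n * g n)     ≡⟨ cong (_* (f n * g n)) (prodBelow-distrib-* n f g) ⟩
  (prodBelow n f * prodBelow n g) * (f n * g n)   ≡⟨ [m*n]*[o*p]≡[m*o]*[n*p] (prodBelow n f) (prodBelow n g) (f n) (g n) ⟩
  (prodBelow n f * f n) * (prodBelow n g * g n)   ∎
  where open ≡-Reasoning

prodBelow-nonZero : ∀ n {f : ℕ → ℕ} → (∀ j → j < n → NonZero (f j)) → NonZero (prodBelow n f)
prodBelow-nonZero zero    nz = _
prodBelow-nonZero (suc n) {f} nz =
  m*n≢0 (prodBelow n f) (f n) {{prodBelow-nonZero n (λ j j<n → nz j (m<n⇒m<1+n j<n))}} {{nz n ≤-refl}}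

prodBelow-suc≡⇔≡ : {f g : ArithFun} → (∀ n → 1 ≤ n → NonZero (f n)) →
  (∀ n → 1 ≤ n → prodBelow n (f ∘ suc) ≡ prodBelow n (g ∘ suc)) ⇔ (∀ n → 1 ≤ n → f n ≡ g n)
prodBelow-suc≡⇔≡ {f} {g} f≢0 = mk⇔ factors≡ (λ f≡g n _ → prodBelow-cong n (λ j _ → f≡g (suc j) (s≤s z≤n)))
  where
  factors≡ : (∀ n → 1 ≤ n → prodBelow n (f ∘ suc) ≡ prodBelow n (g ∘ suc)) → ∀ n → 1 ≤ n → f n ≡ g n
  factors≡ prods≡ (suc j) _ =
    *-cancelˡ-≡ (f (suc j)) (g (suc j)) (prodBelow j (f ∘ suc))
      {{prodBelow-nonZero j (λ i _ → f≢0 (suc i) (s≤s z≤n))}}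
      (trans (prods≡ (suc j) (s≤s z≤n)) (cong (_* g (suc j)) (sym (prefix≡ j))))
    where
    prefix≡ : ∀ j → prodBelow j (f ∘ suc) ≡ prodBelow j (g ∘ suc)
    prefix≡ zero    = refl
    prefix≡ (suc j) = prods≡ (suc j) (s≤s z≤n)

m<n⇒[m+k*n]/n≡k : ∀ m k n .{{_ : NonZero n}} → m < n → (m + k * n) / n ≡ k
m<n⇒[m+k*n]/n≡k m k n m<n = begin
  (m + k * n) / n     ≡⟨ +-distrib-/-∣ʳ m (divides k refl) ⟩
  m / n + k * n / n   ≡⟨ cong₂ _+_ (m<n⇒m/n≡0 m<n) (m*n/n≡m k n) ⟩
  k                   ∎
  where open ≡-Reasoning

[1+n]/d≡1+n/d : ∀ n d .{{_ : NonZero d}} → d ∣ suc n → suc n / d ≡ suc (n / d)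
[1+n]/d≡1+n/d n d@(suc _) d∣1+n = begin
  suc n / d
    ≡⟨ /-congˡ (cong suc (m≡m%n+[m/n]*n n d)) ⟩
  suc (n % d + n / d * d) / d
    ≡⟨ cong (λ r → suc (r + n / d * d) / d) (%-pred-≡0 (n∣m⇒m%n≡0 (suc n) d d∣1+n)) ⟩
  suc (n / d) * d / d
    ≡⟨ m*n/n≡m (suc (n / d)) d ⟩
  suc (n / d)
    ∎
  where open ≡-Reasoning

[1+n]/d≡n/d : ∀ n d .{{_ : NonZero d}} → ¬ d ∣ suc n → suc n / d ≡ n / d
[1+n]/d≡n/d n d d∤1+n with m≤n⇒m<n∨m≡n (m%n<n n d)
... | inj₁ 1+r<d = begin
  suc n / d                     ≡⟨ /-congˡ (cong suc (m≡m%n+[m/n]*n n d)) ⟩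
  (suc (n % d) + n / d * d) / d ≡⟨ m<n⇒[m+k*n]/n≡k (suc (n % d)) (n / d) d 1+r<d ⟩
  n / d                         ∎
  where open ≡-Reasoning
... | inj₂ 1+r≡d = contradiction
  (divides (suc (n / d)) (trans (cong suc (m≡m%n+[m/n]*n n d)) (cong (_+ n / d * d) 1+r≡d))) d∤1+n

NondecreasingFrom1 : ArithFun → Set
NondecreasingFrom1 x = ∀ m → 1 ≤ m → x m ≤ x (suc m)

superadditive⇒nondecreasing : ∀ {x} → Superadditive x → NondecreasingFrom1 x
superadditive⇒nondecreasing {x} x-super m 1≤m =
  ≤-trans (m≤m+n (x m) (x 1)) (subst (λ k → x m + x 1 ≤ x k) (+-comm m 1) (x-super m 1 1≤m ≤-refl))

x[1+q]≡x[q]+Δx[1+q] : ∀ {x} → NondecreasingFrom1 x → ∀ q → 1 ≤ q → x (suc q) ≡ x q + Δ x (suc q)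
x[1+q]≡x[q]+Δx[1+q] x-mono q@(suc _) 1≤q = sym (m+[n∸m]≡n (x-mono q 1≤q))

expConvTerm : ArithFun → ArithFun → ℕ → ℕ → ℕ
expConvTerm a b n j = if isYes (suc j ∣? n) then b (suc j) ^ a (n / suc j) else 1

y^x[1+n/k]-split : ∀ {x} y → NondecreasingFrom1 x → ∀ n j → j < n →
  y (suc j) ^ x (suc n / suc j) ≡ y (suc j) ^ x (n / suc j) * expConvTerm (Δ x) y (suc n) j
y^x[1+n/k]-split {x} y x-mono n j j<n with suc j ∣? suc n
... | yes k∣1+n = begin
  y k ^ x (suc n / k)
    ≡⟨ cong (λ q → y k ^ x q) ([1+n]/d≡1+n/d n k k∣1+n) ⟩
  y k ^ x (suc (n / k))
    ≡⟨ cong (y k ^_) (x[1+q]≡x[q]+Δx[1+q] x-mono (n / k) (m≥n⇒m/n>0 j<n)) ⟩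
  y k ^ (x (n / k) + Δ x (suc (n / k)))
    ≡⟨ ^-distribˡ-+-* (y k) (x (n / k)) _ ⟩
  y k ^ x (n / k) * y k ^ Δ x (suc (n / k))
    ≡⟨ cong (λ q → y k ^ x (n / k) * y k ^ Δ x q) ([1+n]/d≡1+n/d n k k∣1+n) ⟨
  y k ^ x (n / k) * y k ^ Δ x (suc n / k)
    ∎
  where
  open ≡-Reasoning
  k = suc j
... | no k∤1+n = trans (cong (λ q → y (suc j) ^ x q) ([1+n]/d≡n/d n (suc j) k∤1+n)) (sym (*-identityʳ _))

y^x[n/n]≡expConvTerm : ∀ x y n → y (suc n) ^ x (suc n / suc n) ≡ expConvTerm (Δ x) y (suc n) n
y^x[n/n]≡expConvTerm x y n with suc n ∣? suc n
... | yes _ = trans (cong (λ q → y (suc n) ^ x q) (n/n≡1 (suc n)))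
                   (cong (λ q → y (suc n) ^ Δ x q) (sym (n/n≡1 (suc n))))
... | no n∤n = contradiction ∣-refl n∤n

fact-suc : ∀ {x} y → NondecreasingFrom1 x → ∀ n → fact x y (suc n) ≡ fact x y n * expConv (Δ x) y (suc n)
fact-suc {x} y x-mono n = begin
  prodBelow n (λ j → y (suc j) ^ x (suc n / suc j)) * y (suc n) ^ x (suc n / suc n)
    ≡⟨ cong₂ _*_ (prodBelow-cong n (y^x[1+n/k]-split y x-mono n)) (y^x[n/n]≡expConvTerm x y n) ⟩
  prodBelow n (λ j → y (suc j) ^ x (n / suc j) * term j) * term n
    ≡⟨ cong (_* term n) (prodBelow-distrib-* n _ term) ⟩
  (fact x y n * prodBelow n term) * term n
    ≡⟨ *-assoc (fact x y n) _ _ ⟩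
  fact x y n * expConv (Δ x) y (suc n)
    ∎
  where
  open ≡-Reasoning
  term = expConvTerm (Δ x) y (suc n)

fact≡prodBelow-expConvΔ : ∀ {x} y → NondecreasingFrom1 x →
  ∀ n → fact x y n ≡ prodBelow n (λ m → expConv (Δ x) y (suc m))
fact≡prodBelow-expConvΔ y x-mono zero    = refl
fact≡prodBelow-expConvΔ {x} y x-mono (suc n) =
  trans (fact-suc y x-mono n) (cong (_* expConv (Δ x) y (suc n)) (fact≡prodBelow-expConvΔ y x-mono n))

expConv-congˡ : ∀ {a a′} b → (∀ q → 1 ≤ q → a q ≡ a′ q) → ∀ n → expConv a b n ≡ expConv a′ b n
expConv-congˡ {a} {a′} b a≡a′ n = prodBelow-cong n term≡
  where
  term≡ : ∀ j → j < n → expConvTerm a b n j ≡ expConvTerm a′ b n j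
  term≡ j j<n with suc j ∣? n
  ... | yes _ = cong (b (suc j) ^_) (a≡a′ (n / suc j) (m≥n⇒m/n>0 j<n))
  ... | no _  = refl

expConv-nonZero : ∀ a {b} → PositiveValued b → ∀ n → NonZero (expConv a b n)
expConv-nonZero a {b} b-pos n = prodBelow-nonZero n term≢0
  where
  term≢0 : ∀ j → j < n → NonZero (expConvTerm a b n j)
  term≢0 j _ with suc j ∣? n
  ... | yes _ = m^n≢0 (b (suc j)) (a (n / suc j)) {{>-nonZero (b-pos (suc j) (s≤s z≤n))}}
  ... | no _  = _

ΔId≡one : ∀ q → 1 ≤ q → Δ Id q ≡ one q
ΔId≡one (suc zero)    _ = refl
ΔId≡one (suc (suc q)) _ = m+n∸n≡m 1 q

fact-Id≡prodBelow-expConv-one : ∀ β n → fact Id β n ≡ prodBelow n (λ m → expConv one β (suc m))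
fact-Id≡prodBelow-expConv-one β n =
  trans (fact≡prodBelow-expConvΔ β (λ m _ → n≤1+n m) n)
        (prodBelow-cong n (λ m _ → expConv-congˡ β ΔId≡one (suc m)))

∀≥1-≡-cong : {F F′ G G′ : ℕ → ℕ} → (∀ n → F n ≡ F′ n) → (∀ n → G n ≡ G′ n) →
  (∀ n → 1 ≤ n → F n ≡ G n) ⇔ (∀ n → 1 ≤ n → F′ n ≡ G′ n)
∀≥1-≡-cong F≡F′ G≡G′ = mk⇔
  (λ F≡G n 1≤n → trans (sym (F≡F′ n)) (trans (F≡G n 1≤n) (G≡G′ n)))
  (λ F′≡G′ n 1≤n → trans (F≡F′ n) (trans (F′≡G′ n 1≤n) (sym (G≡G′ n))))

mainTheorem5 : (β x y : ArithFun) → PositiveValued β → PositiveValued x → Superadditive x → PositiveValued y →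
    ((∀ n → 1 ≤ n → fact Id β n ≡ fact x y n) ⇔ (∀ n → 1 ≤ n → expConv one β n ≡ expConv (Δ x) y n))
mainTheorem5 β x y β-pos _ x-super _ =
  ⇔-trans
    (∀≥1-≡-cong (fact-Id≡prodBelow-expConv-one β)
                (fact≡prodBelow-expConvΔ y (superadditive⇒nondecreasing x-super)))
    (prodBelow-suc≡⇔≡ (λ n _ → expConv-nonZero one β-pos n))
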